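{- Let $L$ be a planar triangulation with $n_L\ge 4$ vertices, let $H$ be its planar conjugated triangulation with edges $e_1,\dots,e_{m_H}$, and orient every edge of $H$ in the direction in which it is traversed by a fixed Eulerian circuit of $H$. Let $R=(r_{ij})$ be the $m_H\times m_H$ $0$–$1$ matrix with $r_{ij}=1$ if and only if the head of $e_i$ equals the tail of $e_j$. Then $R$ is anti-symmetric: $r_{ij}r_{ji}=0$ for all $i,j$.
   Context: A planar triangulation is a maximal planar simple graph, embedded in the plane so that every face (including the unbounded one) is a triangle. The planar conjugated triangulation $H$ of $L$ is the plane graph whose vertices are the midpoints of the edges of $L$, and in which, for every face of $L$, including the unbounded one, the three midpoints of its boundary edges are joined pairwise by three curves drawn inside that face (the medial graph of $L$); every vertex of $H$ has degree $4$, so $H$ has an Eulerian circuit. $R$ is the adjacency matrix of the edges of the oriented graph $H$. -}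

module Defs where

open import Data.Nat using (ℕ; zero; suc; _+_; _*_; _≤_; _%_)
open import Data.Nat.DivMod using (m%n<n)
open import Data.Fin using (Fin; toℕ; fromℕ<)
open import Data.Fin.Properties using () renaming (_≟_ to _≟ᶠ_)
open import Data.Product using (Σ; ∃; _×_; _,_)
open import Data.Sum using (_⊎_)
open import Relation.Nullary using (¬_; yes; no)
open import Relation.Binary.PropositionalEquality using (_≡_)
open import Function.Definitions using (Bijective; Surjective)

iter : ∀ {A : Set} → (A → A) → ℕ → A → A
iter f zero    x = x
iter f (suc k) x = f (iter f k x)

data Reach {D : Set} (σ α : D → D) : D → D → Set where
  here  : ∀ {d} → Reach σ α d d
  viaσ  : ∀ {d d'} → Reach σ α (σ d) d' → Reach σ α d d'
  viaα  : ∀ {d d'} → Reach σ α (α d) d' → Reach σ α d d'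

-- A planar triangulation L, given as a combinatorial map (rotation system)
-- on the dart set Fin nD:
--   α : the fixed-point-free involution pairing the two darts of an edge,
--   σ : the rotation (cyclic order of darts around each vertex),
--   φ = σ ∘ α : face permutation; faces are φ-orbits.
-- vert / edge label darts by their vertex (σ-orbit) and edge (α-orbit).
-- Planarity (genus 0) is Euler's formula V - E + F = 2, which with
-- E = nD/2 and F = nD/3 reads nD + 12 = 6 nV.
record PlanarTriangulation : Set where
  field
    nV nE nD : ℕ
    α σ   : Fin nD → Fin nD
    vert  : Fin nD → Fin nV
    edge  : Fin nD → Fin nE
    α-invol   : ∀ d → α (α d) ≡ d
    α-nofix   : ∀ d → ¬ (α d ≡ d)
    σ-bij     : Bijective _≡_ _≡_ σ
    vert-surj : Surjective _≡_ _≡_ vert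
    vert-orb  : ∀ d d' → (vert d ≡ vert d' → ∃ λ k → iter σ k d ≡ d')
                       × ((∃ λ k → iter σ k d ≡ d') → vert d ≡ vert d')
    edge-surj : Surjective _≡_ _≡_ edge
    edge-orb  : ∀ d d' → (edge d ≡ edge d' → (d' ≡ d ⊎ d' ≡ α d))
                       × ((d' ≡ d ⊎ d' ≡ α d) → edge d ≡ edge d')
    face-tri1 : ∀ d → ¬ (σ (α d) ≡ d)
    face-tri3 : ∀ d → σ (α (σ (α (σ (α d))))) ≡ d
    connected : ∀ d d' → Reach σ α d d'
    no-loop   : ∀ d → ¬ (vert d ≡ vert (α d))
    no-multi  : ∀ d d' → vert d ≡ vert d' → vert (α d) ≡ vert (α d') → d ≡ d'
    euler     : nD + 12 ≡ 6 * nV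

  φ : Fin nD → Fin nD
  φ d = σ (α d)

-- The conjugated (medial) graph H of L: vertices are the edges of L
-- (Fin nE); for every face of L and every dart d on it, H has an edge
-- joining edge d and edge (φ d) (the curve in that face between the
-- midpoints of two consecutive boundary edges).
module Conjugated (L : PlanarTriangulation) where
  open PlanarTriangulation L public

  HVertex : Set
  HVertex = Fin nE

  HEdge : Set
  HEdge = Fin nD

  mH : ℕ
  mH = nD

  end₁ end₂ : HEdge → HVertex
  end₁ d = edge d
  end₂ d = edge (φ d)

cycSuc : ∀ {n} → Fin n → Fin n
cycSuc {suc n} i = fromℕ< (m%n<n (suc (toℕ i)) (suc n))

-- An Eulerian circuit of H, with the orientation it induces:
-- at step i (i = 0..m_H-1, cyclically) the circuit traverses the H-edge
-- e i from tail i to head i; every H-edge is traversed exactly once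
-- (e is a bijection), and consecutive steps are joined.
record EulerianCircuit (L : PlanarTriangulation) : Set where
  open Conjugated L
  field
    e     : Fin mH → HEdge
    tail head : Fin mH → HVertex
    e-bij : Bijective _≡_ _≡_ e
    e-ends : ∀ i → (tail i ≡ end₁ (e i) × head i ≡ end₂ (e i))
                 ⊎ (tail i ≡ end₂ (e i) × head i ≡ end₁ (e i))
    closed : ∀ i → head i ≡ tail (cycSuc i)

  R : Fin mH → Fin mH → ℕ
  R i j with head i ≟ᶠ tail j
  ... | yes _ = 1
  ... | no  _ = 0

-- H is a simple graph. A loop of H would make two consecutive sides of a face of L the same
-- edge, and two H-edges with the same ends would force a loop, a multiple edge or a vertex of
-- degree at most 2 in L. The last is impossible when L has at least four vertices: a degree-2
-- vertex spans a component of six darts closed under σ and α, while Euler's formula gives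
-- more than six darts. In a simple graph two oriented edges cannot run head-to-tail in both
-- directions, so r_ij r_ji = 0.
module Submission where

open import Defs
open import Data.Nat using (_*_; _≤_; _<_)
import Data.Nat.Properties as ℕ
open import Data.Fin using (Fin; zero; suc)
open import Data.Fin.Properties using (injective⇒≤) renaming (_≟_ to _≟ᶠ_)
open import Data.Product using (∃; _×_; _,_; proj₁; proj₂)
open import Data.Sum using (_⊎_; inj₁; inj₂)
open import Data.Empty using (⊥; ⊥-elim)
open import Relation.Nullary using (yes; no)
open import Relation.Binary.PropositionalEquality
  using (_≡_; _≢_; refl; sym; trans; cong; subst)

Reach-closed : ∀ {D : Set} {σ α : D → D} (P : D → Set)
  → (∀ {x} → P x → P (σ x)) → (∀ {x} → P x → P (α x))
  → ∀ {x y} → Reach σ α x y → P x → P y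
Reach-closed P Pσ Pα here     Px = Px
Reach-closed P Pσ Pα (viaσ r) Px = Reach-closed P Pσ Pα r (Pσ Px)
Reach-closed P Pσ Pα (viaα r) Px = Reach-closed P Pσ Pα r (Pα Px)

covering⇒≤ : ∀ {m n} (f : Fin m → Fin n) → (∀ y → ∃ λ i → f i ≡ y) → n ≤ m
covering⇒≤ f cover = injective⇒≤ {f = λ y → proj₁ (cover y)}
  λ {x} {y} eq → trans (sym (proj₂ (cover x))) (trans (cong f eq) (proj₂ (cover y)))

module Triangulation (L : PlanarTriangulation) where
  open PlanarTriangulation L

  vert-σ : ∀ d → vert (σ d) ≡ vert d
  vert-σ d = sym (proj₂ (vert-orb d (σ d)) (1 , refl))

  vert-φ : ∀ d → vert (φ d) ≡ vert (α d)
  vert-φ d = vert-σ (α d)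

  φ-α : ∀ d → φ (α d) ≡ σ d
  φ-α d = cong σ (α-invol d)

  φ²-inverse : ∀ {d d'} → φ d ≡ d' → φ (φ d') ≡ d
  φ²-inverse {d} refl = face-tri3 d

  σ-injective : ∀ {d d'} → σ d ≡ σ d' → d ≡ d'
  σ-injective = proj₁ σ-bij

  edge-≡ : ∀ {d d'} → edge d ≡ edge d' → d' ≡ d ⊎ d' ≡ α d
  edge-≡ {d} {d'} = proj₁ (edge-orb d d')

  6<nD : 4 ≤ nV → 6 < nD
  6<nD 4≤nV = ℕ.+-cancelʳ-< 12 6 nD (subst (18 <_) (sym euler) (ℕ.*-monoʳ-< 6 4≤nV))

  -- A vertex of degree 1 at d would make the edge of L at φ d a loop.
  σ-nofix : ∀ d → σ d ≢ d
  σ-nofix d σd≡d = no-loop (φ d)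
    (trans (vert-φ d) (trans (cong vert (sym φ²d≡αd)) (vert-φ (φ d))))
    where
    φ²d≡αd : φ (φ d) ≡ α d
    φ²d≡αd = φ²-inverse (trans (φ-α d) σd≡d)

  module DegreeTwo (a : Fin nD) (σ²a≡a : σ (σ a) ≡ a) where
    b : Fin nD
    b = σ a

    φ²b≡αa : φ (φ b) ≡ α a
    φ²b≡αa = φ²-inverse (φ-α a)

    φ²a≡αb : φ (φ a) ≡ α b
    φ²a≡αb = φ²-inverse (trans (φ-α b) σ²a≡a)

    -- The two faces at a and b share their third edge, since L has no multiple edges.
    φa≡αφb : φ a ≡ α (φ b)
    φa≡αφb = no-multi (φ a) (α (φ b))
      (trans (vert-φ a) (trans (cong vert (sym φ²b≡αa)) (vert-φ (φ b))))
      (trans (sym (vert-φ (φ a))) (trans (cong vert φ²a≡αb)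
        (trans (sym (vert-φ b)) (cong vert (sym (α-invol (φ b)))))))

    φb≡αφa : φ b ≡ α (φ a)
    φb≡αφa = trans (sym (α-invol (φ b))) (cong α (sym φa≡αφb))

    darts : Fin 6 → Fin nD
    darts zero                               = a
    darts (suc zero)                         = b
    darts (suc (suc zero))                   = α a
    darts (suc (suc (suc zero)))             = α b
    darts (suc (suc (suc (suc zero))))       = φ a
    darts (suc (suc (suc (suc (suc zero))))) = φ b

    InDarts : Fin nD → Set
    InDarts x = ∃ λ k → darts k ≡ x

    σ-darts : ∀ k → InDarts (σ (darts k))
    σ-darts zero                               = suc zero , refl
    σ-darts (suc zero)                         = zero , sym σ²a≡a
    σ-darts (suc (suc zero))                   = suc (suc (suc (suc zero))) , refl
    σ-darts (suc (suc (suc zero)))             = suc (suc (suc (suc (suc zero)))) , refl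
    σ-darts (suc (suc (suc (suc zero))))       = suc (suc zero) , sym (trans (cong σ φa≡αφb) φ²b≡αa)
    σ-darts (suc (suc (suc (suc (suc zero))))) = suc (suc (suc zero)) , sym (trans (cong σ φb≡αφa) φ²a≡αb)

    α-darts : ∀ k → InDarts (α (darts k))
    α-darts zero                               = suc (suc zero) , refl
    α-darts (suc zero)                         = suc (suc (suc zero)) , refl
    α-darts (suc (suc zero))                   = zero , sym (α-invol a)
    α-darts (suc (suc (suc zero)))             = suc zero , sym (α-invol b)
    α-darts (suc (suc (suc (suc zero))))       = suc (suc (suc (suc (suc zero)))) , φb≡αφa
    α-darts (suc (suc (suc (suc (suc zero))))) = suc (suc (suc (suc zero))) , φa≡αφb

    all-InDarts : ∀ x → InDarts x
    all-InDarts x = Reach-closed InDarts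
      (λ { (k , refl) → σ-darts k }) (λ { (k , refl) → α-darts k })
      (connected a x) (zero , refl)

    nD≤6 : nD ≤ 6
    nD≤6 = covering⇒≤ darts all-InDarts

  σ²-nofix : 6 < nD → ∀ d → σ (σ d) ≢ d
  σ²-nofix 6<nD d σ²d≡d = ℕ.<⇒≱ 6<nD (DegreeTwo.nD≤6 d σ²d≡d)

  edge-≢-φ : ∀ d → edge d ≢ edge (φ d)
  edge-≢-φ d eq with edge-≡ eq
  ... | inj₁ φd≡d  = face-tri1 d φd≡d
  ... | inj₂ φd≡αd = σ-nofix (α d) φd≡αd

  edge-φ-injective : ∀ {d d'} → edge d ≡ edge d' → edge (φ d) ≡ edge (φ d') → d ≡ d'
  edge-φ-injective {d} e₁ e₂ with edge-≡ e₁
  ... | inj₁ refl = refl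
  ... | inj₂ refl with edge-≡ e₂
  ...   | inj₁ φαd≡φd = ⊥-elim (α-nofix d (sym (trans (sym (α-invol d)) (σ-injective φαd≡φd))))
  ...   | inj₂ φαd≡αφd = ⊥-elim (σ-nofix (α d) (no-multi (φ d) (α d) (vert-φ d)
          (trans (cong vert (sym φαd≡αφd)) (trans (cong vert (φ-α d))
            (trans (vert-σ d) (cong vert (sym (α-invol d))))))))

  edge-φ-not-crossed : 6 < nD → ∀ {d d'} → edge d ≡ edge (φ d') → edge (φ d) ≡ edge d' → ⊥
  edge-φ-not-crossed 6<nD {d} e₁ e₂ with edge-≡ e₂ | edge-≡ (sym e₁)
  ... | inj₁ refl | inj₁ d≡φ²d  = face-tri1 d (trans (cong φ d≡φ²d) (face-tri3 d))
  ... | inj₁ refl | inj₂ d≡αφ²d =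
        σ-nofix d (trans (sym (φ-α d)) (trans (cong φ αd≡φ²d) (face-tri3 d)))
    where
    αd≡φ²d : α d ≡ φ (φ d)
    αd≡φ²d = trans (cong α d≡αφ²d) (α-invol _)
  ... | inj₂ refl | inj₁ d≡σ²αd =
        no-loop d (trans (cong vert (trans d≡σ²αd (φ-α (φ d))))
                         (trans (vert-σ (σ (α d))) (vert-σ (α d))))
  ... | inj₂ refl | inj₂ d≡αφαφd =
        σ²-nofix 6<nD (α d) (sym (trans (cong α d≡αφαφd) (trans (α-invol _) (φ-α (φ d)))))

module Medial (L : PlanarTriangulation) where
  open Conjugated L
  open Triangulation L

  Parallel : HEdge → HEdge → Set
  Parallel d d' = (end₁ d ≡ end₁ d' × end₂ d ≡ end₂ d')
                ⊎ (end₁ d ≡ end₂ d' × end₂ d ≡ end₁ d')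

  parallel⇒≡ : 6 < nD → ∀ d d' → Parallel d d' → d ≡ d'
  parallel⇒≡ _    d d' (inj₁ (e₁ , e₂)) = edge-φ-injective e₁ e₂
  parallel⇒≡ 6<nD d d' (inj₂ (e₁ , e₂)) = ⊥-elim (edge-φ-not-crossed 6<nD e₁ e₂)

module Circuit {L : PlanarTriangulation} (C : EulerianCircuit L) where
  open Conjugated L
  open Medial L using (Parallel)
  open EulerianCircuit C

  step-ends-≡ : ∀ i → head i ≡ tail i → end₁ (e i) ≡ end₂ (e i)
  step-ends-≡ i h≡t with e-ends i
  ... | inj₁ (t , h) = trans (sym t) (trans (sym h≡t) h)
  ... | inj₂ (t , h) = trans (sym h) (trans h≡t t)

  opposite-steps-parallel : ∀ i j → head i ≡ tail j → head j ≡ tail i → Parallel (e i) (e j)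
  opposite-steps-parallel i j p q with e-ends i | e-ends j
  ... | inj₁ (ti , hi) | inj₁ (tj , hj) =
        inj₂ (trans (sym ti) (trans (sym q) hj) , trans (sym hi) (trans p tj))
  ... | inj₁ (ti , hi) | inj₂ (tj , hj) =
        inj₁ (trans (sym ti) (trans (sym q) hj) , trans (sym hi) (trans p tj))
  ... | inj₂ (ti , hi) | inj₁ (tj , hj) =
        inj₁ (trans (sym hi) (trans p tj) , trans (sym ti) (trans (sym q) hj))
  ... | inj₂ (ti , hi) | inj₂ (tj , hj) =
        inj₂ (trans (sym hi) (trans p tj) , trans (sym ti) (trans (sym q) hj))

  module _ (loopless : ∀ d → end₁ d ≢ end₂ d) (simple : ∀ d d' → Parallel d d' → d ≡ d') where

    no-opposite-steps : ∀ i j → head i ≡ tail j → head j ≡ tail i → ⊥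
    no-opposite-steps i j p q with proj₁ e-bij (simple _ _ (opposite-steps-parallel i j p q))
    ... | refl = loopless (e i) (step-ends-≡ i p)

    R-antisymmetric : ∀ i j → R i j * R j i ≡ 0
    R-antisymmetric i j with head i ≟ᶠ tail j | head j ≟ᶠ tail i
    ... | no _  | _     = refl
    ... | yes _ | no _  = refl
    ... | yes p | yes q = ⊥-elim (no-opposite-steps i j p q)

theorem19 : (L : PlanarTriangulation) → 4 ≤ PlanarTriangulation.nV L
    → (C : EulerianCircuit L)
    → ∀ i j → EulerianCircuit.R C i j * EulerianCircuit.R C j i ≡ 0
theorem19 L 4≤nV C = Circuit.R-antisymmetric C edge-≢-φ (parallel⇒≡ (6<nD 4≤nV))
  where
  open Medial L using (parallel⇒≡)
  open Triangulation L using (6<nD; edge-≢-φ)
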